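{- Let $\langle A,\succ,1\rangle$ be a ${\rm G}_4^0$-algebra with least element $0$. Define $\sim x=x\succ 0$, $x\multimap y=x\succ(x\succ y)$ and $\nabla x=\sim x\succ x$. Then for all $x\in A$: (G'33) $\sim x\multimap x=\sim x\succ x$; (G'34) $x\leq\nabla x$, where $a\leq b$ means $a\succ b=1$.
   Context: A G-algebra is an algebra $\langle A,\succ,1\rangle$ of type $(2,0)$ satisfying for all $x,y,z$: (G1) $1\succ x=x$; (G2) $x\succ 1=1$; (G3) $(x\succ y)\succ y=(y\succ x)\succ x$; (G4) if $x\succ(y\succ z)=1$ then $y\succ(x\succ z)=1$. The relation $x\leq y$ iff $x\succ y=1$ is a partial order. A ${\rm G}^0$-algebra is a G-algebra with an element $0$ such that $0\leq x$ for all $x$. A ${\rm G}_4^0$-algebra is a ${\rm G}^0$-algebra satisfying $((x\succ(x\succ y))\succ x)\succ x=1$ for all $x,y$. -}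

module Defs where

open import Level using (Level; suc)
open import Relation.Binary.PropositionalEquality using (_≡_)

record IsGAlgebra {a : Level} (A : Set a) (_≻_ : A → A → A) (𝟏 : A) : Set a where
  field
    G1 : ∀ x → 𝟏 ≻ x ≡ x
    G2 : ∀ x → x ≻ 𝟏 ≡ 𝟏
    G3 : ∀ x y → (x ≻ y) ≻ y ≡ (y ≻ x) ≻ x
    G4 : ∀ x y z → x ≻ (y ≻ z) ≡ 𝟏 → y ≻ (x ≻ z) ≡ 𝟏

record G04Algebra (a : Level) : Set (suc a) where
  field
    Carrier    : Set a
    _≻_        : Carrier → Carrier → Carrier
    𝟏          : Carrier
    𝟎          : Carrier
    isGAlgebra : IsGAlgebra Carrier _≻_ 𝟏
    least      : ∀ x → 𝟎 ≻ x ≡ 𝟏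
    G4-axiom   : ∀ x y → ((x ≻ (x ≻ y)) ≻ x) ≻ x ≡ 𝟏

  open IsGAlgebra isGAlgebra public

  _≤_ : Carrier → Carrier → Set a
  x ≤ y = x ≻ y ≡ 𝟏

  ∼_ : Carrier → Carrier
  ∼ x = x ≻ 𝟎

  _⊸_ : Carrier → Carrier → Carrier
  x ⊸ y = x ≻ (x ≻ y)

  ∇_ : Carrier → Carrier
  ∇ x = (∼ x) ≻ x

-- In a G⁰-algebra negation is involutive (∼ ∼ x = x, from (G3) with y = 0), and
-- the G⁰₄ axiom, rewritten with (G3), says x ≻ (x ⊸ y) ≤ x ⊸ y; with (K) this
-- gives x ≻ (x ⊸ y) = x ⊸ y, so z ↦ x ≻ z stabilises after two steps. Taking x := ∼ x and y := 0 gives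
-- ∼ x ⊸ x = ∼ x ⊸ ∼ ∼ x = ∼ x ⊸ 0 = ∼ x ≻ x, and x ≤ ∇ x is an instance of (K).
module Submission where

open import Defs
open import Level using (Level)
open import Data.Product using (_×_; _,_)
open import Relation.Binary.PropositionalEquality
  using (_≡_; sym; trans; cong; module ≡-Reasoning)

module GAlgebraProperties {a : Level} {A : Set a} {_≻_ : A → A → A} {𝟏 : A}
                          (G : IsGAlgebra A _≻_ 𝟏) where
  open IsGAlgebra G
  open ≡-Reasoning

  ≻-refl : ∀ x → x ≻ x ≡ 𝟏
  ≻-refl x = begin
    x ≻ x          ≡⟨ cong (_≻ x) (G1 x) ⟨
    (𝟏 ≻ x) ≻ x    ≡⟨ G3 𝟏 x ⟩
    (x ≻ 𝟏) ≻ 𝟏    ≡⟨ G2 (x ≻ 𝟏) ⟩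
    𝟏              ∎

  ≻-K : ∀ x y → x ≻ (y ≻ x) ≡ 𝟏
  ≻-K x y = G4 y x x (trans (cong (y ≻_) (≻-refl x)) (G2 y))

  ≤-antisym : ∀ {x y} → x ≻ y ≡ 𝟏 → y ≻ x ≡ 𝟏 → x ≡ y
  ≤-antisym {x} {y} x≤y y≤x = begin
    x              ≡⟨ G1 x ⟨
    𝟏 ≻ x          ≡⟨ cong (_≻ x) y≤x ⟨
    (y ≻ x) ≻ x    ≡⟨ G3 y x ⟩
    (x ≻ y) ≻ y    ≡⟨ cong (_≻ y) x≤y ⟩
    𝟏 ≻ y          ≡⟨ G1 y ⟩
    y              ∎

module G04AlgebraProperties {a : Level} (𝔸 : G04Algebra a) where
  open G04Algebra 𝔸
  open GAlgebraProperties isGAlgebra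
  open ≡-Reasoning

  ∼-involutive : ∀ x → ∼ (∼ x) ≡ x
  ∼-involutive x = begin
    (x ≻ 𝟎) ≻ 𝟎    ≡⟨ G3 x 𝟎 ⟩
    (𝟎 ≻ x) ≻ x    ≡⟨ cong (_≻ x) (least x) ⟩
    𝟏 ≻ x          ≡⟨ G1 x ⟩
    x              ∎

  ⊸-contract : ∀ x y → (x ≻ (x ⊸ y)) ≤ (x ⊸ y)
  ⊸-contract x y = trans (sym (G3 (x ⊸ y) x)) (G4-axiom x y)

  ⊸-idem : ∀ x y → x ⊸ (x ≻ y) ≡ x ⊸ y
  ⊸-idem x y = ≤-antisym (⊸-contract x y) (≻-K (x ⊸ y) x)

  ∼⊸-self : ∀ x → (∼ x) ⊸ x ≡ (∼ x) ≻ x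
  ∼⊸-self x = begin
    (∼ x) ⊸ x            ≡⟨ cong ((∼ x) ⊸_) (∼-involutive x) ⟨
    (∼ x) ⊸ (∼ (∼ x))    ≡⟨ ⊸-idem (∼ x) 𝟎 ⟩
    (∼ x) ⊸ 𝟎            ≡⟨ cong ((∼ x) ≻_) (∼-involutive x) ⟩
    (∼ x) ≻ x            ∎

lemma3p4 : {a : Level} (𝔸 : G04Algebra a) → let open G04Algebra 𝔸 in
    ∀ x → (((∼ x) ⊸ x) ≡ ((∼ x) ≻ x)) × (x ≤ (∇ x))
lemma3p4 𝔸 x = ∼⊸-self x , ≻-K x (∼ x)
  where
  open G04Algebra 𝔸
  open G04AlgebraProperties 𝔸
  open GAlgebraProperties isGAlgebra
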